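{- Let $m>0$ and let $a,b,a',b',c$ be integers with $2\le a<a'\le b'<b\le c$ such that $(F(a),F(b),F(c))$ and $(F(a'),F(b'),F(c))$ are both minimal Markoff $m$-triples (for the same $m$). Then $a+b=a'+b'$.
   Context: $F(n)$ denotes the $n$-th Fibonacci number, $F(0)=0$, $F(1)=1$, $F(n+1)=F(n)+F(n-1)$. A Markoff $m$-triple is a triple $(x,y,z)$ of positive integers with $x\le y\le z$ satisfying $x^2+y^2+z^2=3xyz+m$; it is minimal if $z\ge 3xy$. -}

module Defs where

open import Data.Nat using (ℕ; zero; suc; _+_; _*_; _≤_; _<_)
open import Data.Product using (_×_)
open import Relation.Binary.PropositionalEquality using (_≡_)

F : ℕ → ℕ
F zero = 0
F (suc zero) = 1
F (suc (suc n)) = F (suc n) + F n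

MarkoffTriple : ℕ → ℕ → ℕ → ℕ → Set
MarkoffTriple m x y z =
  (0 < x) × (x ≤ y) × (y ≤ z) ×
  (x * x + y * y + z * z ≡ 3 * x * y * z + m)

MinimalMarkoffTriple : ℕ → ℕ → ℕ → ℕ → Set
MinimalMarkoffTriple m x y z = MarkoffTriple m x y z × (3 * x * y ≤ z)

-- Subtracting the Markoff equations of two triples with the same largest entry z gives
-- x² + y² − x'² − y'² = 3z (xy − x'y').  When the first triple is minimal, z ≥ 3xy makes the
-- right-hand side too large unless the two products are close: 8 xy ≤ 9 x'y'.  For Fibonacci
-- entries, F a F b lies between F (a + b − 2) and 2 F (a + b − 3), and F (n + 2) > 9/4 F n for
-- n ≥ 2, so products over index pairs with different sums a + b differ by more than the factor 9/8.
-- Both triples being minimal, this applies in either direction, forcing a + b = a' + b'.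
module Submission where

open import Defs
open import Data.Nat using (ℕ; zero; >-nonZero; suc; _+_; _*_; _≤_; _<_; _≤′_; ≤′-refl; ≤′-step; z≤n; s≤s)
open import Data.Nat.Properties
open import Data.Nat.Tactic.RingSolver using (solve; solve-∀)
open import Data.List using (_∷_; [])
open import Data.Product using (_,_; proj₁)
open import Relation.Binary.Definitions using (tri<; tri≈; tri>)
open import Relation.Binary.PropositionalEquality using (_≡_; refl; sym; trans; cong; cong₂; module ≡-Reasoning)
open import Relation.Nullary using (contradiction)

F-≤-suc : ∀ n → F n ≤ F (suc n)
F-≤-suc zero          = z≤n
F-≤-suc (suc zero)    = ≤-refl
F-≤-suc (suc (suc n)) = m≤m+n (F (suc (suc n))) (F (suc n))

F-mono-≤ : ∀ {m n} → m ≤ n → F m ≤ F n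
F-mono-≤ m≤n = go (≤⇒≤′ m≤n)
  where
  go : ∀ {m n} → m ≤′ n → F m ≤ F n
  go ≤′-refl          = ≤-refl
  go (≤′-step {n} le) = ≤-trans (go le) (F-≤-suc n)

F-suc-pos : ∀ n → 0 < F (suc n)
F-suc-pos n = F-mono-≤ {1} {suc n} (s≤s z≤n)

F-add : ∀ m n → F (suc (m + n)) ≡ F (suc m) * F (suc n) + F m * F n
F-add zero          n = sym (trans (+-identityʳ _) (+-identityʳ _))
F-add (suc zero)    n = sym (cong₂ _+_ (*-identityˡ (F (suc n))) (*-identityˡ (F n)))
F-add (suc (suc m)) n = trans (cong₂ _+_ (F-add (suc m) n) (F-add m n))
                              (regroup (F (suc (suc m))) (F (suc m)) (F m) (F (suc n)) (F n))
  where
  regroup : ∀ a b c e f → (a * e + b * f) + (b * e + c * f) ≡ (a + b) * e + (b + c) * f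
  regroup = solve-∀

chebyshev-sum-inequality : ∀ {p q r s} → q ≤ p → s ≤ r → (p + q) * (r + s) ≤ 2 * (p * r + q * s)
chebyshev-sum-inequality {q = q} {s = s} q≤p s≤r with m≤n⇒∃[o]m+o≡n q≤p | m≤n⇒∃[o]m+o≡n s≤r
... | d , refl | e , refl = begin
    (q + d + q) * (s + e + s)           ≤⟨ m≤m+n _ (d * e) ⟩
    (q + d + q) * (s + e + s) + d * e   ≡⟨ solve (q ∷ s ∷ d ∷ e ∷ []) ⟩
    2 * ((q + d) * (s + e) + q * s)     ∎
  where open ≤-Reasoning

F[2+i+j]≤F[2+i]*F[2+j] : ∀ i j → F (2 + i + j) ≤ F (2 + i) * F (2 + j)
F[2+i+j]≤F[2+i]*F[2+j] i j = begin
    F (2 + i + j)                            ≡⟨ F-add (suc i) j ⟩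
    F (2 + i) * F (1 + j) + F (1 + i) * F j  ≤⟨ +-monoʳ-≤ _ (*-monoˡ-≤ (F j) (F-≤-suc (suc i))) ⟩
    F (2 + i) * F (1 + j) + F (2 + i) * F j  ≡⟨ sym (*-distribˡ-+ (F (2 + i)) (F (1 + j)) (F j)) ⟩
    F (2 + i) * F (2 + j)                    ∎
  where open ≤-Reasoning

F[2+i]*F[2+j]≤2*F[1+i+j] : ∀ i j → F (2 + i) * F (2 + j) ≤ 2 * F (1 + i + j)
F[2+i]*F[2+j]≤2*F[1+i+j] i j = begin
    F (2 + i) * F (2 + j)                        ≤⟨ chebyshev-sum-inequality (F-≤-suc i) (F-≤-suc j) ⟩
    2 * (F (1 + i) * F (1 + j) + F i * F j)      ≡⟨ cong (2 *_) (F-add i j) ⟨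
    2 * F (1 + i + j)                            ∎
  where open ≤-Reasoning

9*F[1+n]<4*F[3+n] : ∀ {n} → 1 ≤ n → 9 * F (1 + n) < 4 * F (3 + n)
9*F[1+n]<4*F[3+n] {suc n} _ = unfolded (F-≤-suc n) (F-suc-pos n)
  where
  unfolded : ∀ {p q} → q ≤ p → 0 < p → 9 * (p + q) < 4 * (p + q + p + (p + q))
  unfolded {p} {q} q≤p 0<p = begin-strict
      9 * (p + q)                 ≡⟨ solve (p ∷ q ∷ []) ⟩
      8 * (p + q) + p + q         <⟨ +-monoʳ-< _ (≤-<-trans q≤p (m<m*n p 3 {{>-nonZero 0<p}} (s≤s (s≤s z≤n)))) ⟩
      8 * (p + q) + p + p * 3     ≡⟨ solve (p ∷ q ∷ []) ⟩
      4 * (p + q + p + (p + q))   ∎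
    where open ≤-Reasoning

F[2+i]*F[2+j]-gap : ∀ i j i' j' → 1 ≤ i + j → i + j < i' + j' →
                    9 * (F (2 + i) * F (2 + j)) < 8 * (F (2 + i') * F (2 + j'))
F[2+i]*F[2+j]-gap i j i' j' 1≤i+j i+j<i'+j' = begin-strict
    9 * (F (2 + i) * F (2 + j))    ≤⟨ *-monoʳ-≤ 9 (F[2+i]*F[2+j]≤2*F[1+i+j] i j) ⟩
    9 * (2 * F (1 + i + j))        ≡⟨ *-assoc 9 2 (F (1 + i + j)) ⟨
    18 * F (1 + i + j)             ≡⟨ *-assoc 2 9 (F (1 + i + j)) ⟩
    2 * (9 * F (1 + i + j))        <⟨ *-monoʳ-< 2 (9*F[1+n]<4*F[3+n] 1≤i+j) ⟩
    2 * (4 * F (3 + i + j))        ≡⟨ *-assoc 2 4 (F (3 + i + j)) ⟨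
    8 * F (3 + i + j)              ≤⟨ *-monoʳ-≤ 8 (F-mono-≤ (s≤s (s≤s i+j<i'+j'))) ⟩
    8 * F (2 + i' + j')            ≤⟨ *-monoʳ-≤ 8 (F[2+i+j]≤F[2+i]*F[2+j] i' j') ⟩
    8 * (F (2 + i') * F (2 + j'))  ∎
  where open ≤-Reasoning

m*m+n*n≤[m*n]*[m*n]+1 : ∀ {m n} → 0 < m → 0 < n → m * m + n * n ≤ (m * n) * (m * n) + 1
m*m+n*n≤[m*n]*[m*n]+1 {suc u} {suc v} _ _ = begin
    suc u * suc u + suc v * suc v
      ≤⟨ m≤m+n _ ((u * u + 2 * u) * (v * v + 2 * v)) ⟩
    suc u * suc u + suc v * suc v + (u * u + 2 * u) * (v * v + 2 * v)
      ≡⟨ solve (u ∷ v ∷ []) ⟩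
    (suc u * suc v) * (suc u * suc v) + 1
      ∎
  where open ≤-Reasoning

markoff-same-z : ∀ {m x y x' y' z} →
  x * x + y * y + z * z ≡ 3 * x * y * z + m →
  x' * x' + y' * y' + z * z ≡ 3 * x' * y' * z + m →
  x * x + y * y + 3 * x' * y' * z ≡ x' * x' + y' * y' + 3 * x * y * z
markoff-same-z {m} {x} {y} {x'} {y'} {z} e e' = +-cancelʳ-≡ (z * z) _ _ (begin
    x * x + y * y + 3 * x' * y' * z + z * z     ≡⟨ solve (x ∷ y ∷ x' ∷ y' ∷ z ∷ []) ⟩
    x * x + y * y + z * z + 3 * x' * y' * z     ≡⟨ cong (_+ 3 * x' * y' * z) e ⟩
    3 * x * y * z + m + 3 * x' * y' * z         ≡⟨ solve (m ∷ x ∷ y ∷ x' ∷ y' ∷ z ∷ []) ⟩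
    3 * x' * y' * z + m + 3 * x * y * z         ≡⟨ cong (_+ 3 * x * y * z) e' ⟨
    x' * x' + y' * y' + z * z + 3 * x * y * z   ≡⟨ solve (x ∷ y ∷ x' ∷ y' ∷ z ∷ []) ⟩
    x' * x' + y' * y' + 3 * x * y * z + z * z   ∎)
  where open ≡-Reasoning

minimal-markoff-product-unfolded : ∀ {m x y x' y' z} →
  MinimalMarkoffTriple m x y z → MarkoffTriple m x' y' z → 8 * (x * y) ≤ 9 * (x' * y')
minimal-markoff-product-unfolded {m} {x} {y} {x'} {y'} {z} ((0<x , x≤y , y≤z , e) , 3xy≤z) (0<x' , _ , _ , e') =
  ≮⇒≥ λ 9x'y'<8xy → <-irrefl refl (begin-strict
    9 * (x * x + y * y + 3 * x' * y' * z)
      <⟨ m<m+n _ 0<3z ⟩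
    9 * (x * x + y * y + 3 * x' * y' * z) + 3 * z
      ≡⟨ solve (x ∷ y ∷ x' ∷ y' ∷ z ∷ []) ⟩
    9 * (x * x + y * y) + 3 * z * suc (9 * (x' * y'))
      ≤⟨ +-mono-≤ (*-monoʳ-≤ 9 (m*m+n*n≤[m*n]*[m*n]+1 0<x 0<y)) (*-monoʳ-≤ (3 * z) 9x'y'<8xy) ⟩
    9 * ((x * y) * (x * y) + 1) + 3 * z * (8 * (x * y))
      ≡⟨ solve (x ∷ y ∷ z ∷ []) ⟩
    9 + 3 * (x * y) * (3 * x * y) + 24 * (x * y) * z
      ≤⟨ +-monoˡ-≤ _ (+-monoʳ-≤ 9 (*-monoʳ-≤ (3 * (x * y)) 3xy≤z)) ⟩
    9 + 3 * (x * y) * z + 24 * (x * y) * z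
      ≡⟨ solve (x ∷ y ∷ z ∷ []) ⟩
    9 * 1 + 9 * (3 * x * y * z)
      ≤⟨ +-monoˡ-≤ _ (*-monoʳ-≤ 9 1≤x'x'+y'y') ⟩
    9 * (x' * x' + y' * y') + 9 * (3 * x * y * z)
      ≡⟨ *-distribˡ-+ 9 (x' * x' + y' * y') (3 * x * y * z) ⟨
    9 * (x' * x' + y' * y' + 3 * x * y * z)
      ≡⟨ cong (9 *_) same-z ⟨
    9 * (x * x + y * y + 3 * x' * y' * z)
      ∎)
  where
  open ≤-Reasoning
  same-z : x * x + y * y + 3 * x' * y' * z ≡ x' * x' + y' * y' + 3 * x * y * z
  same-z = markoff-same-z {m} {x} {y} {x'} {y'} {z} e e'
  0<y : 0 < y
  0<y = ≤-trans 0<x x≤y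
  0<3z : 0 < 3 * z
  0<3z = ≤-trans (≤-trans 0<y y≤z) (m≤m+n z (2 * z))
  1≤x'x'+y'y' : 1 ≤ x' * x' + y' * y'
  1≤x'x'+y'y' = ≤-trans (*-mono-≤ 0<x' 0<x') (m≤m+n _ _)

lemma4p16 : (m a b a' b' c : ℕ) → 0 < m →
              2 ≤ a → a < a' → a' ≤ b' → b' < b → b ≤ c →
              MinimalMarkoffTriple m (F a) (F b) (F c) →
              MinimalMarkoffTriple m (F a') (F b') (F c) →
              a + b ≡ a' + b'
lemma4p16 _ (suc (suc i)) (suc (suc j)) (suc (suc i')) (suc (suc j')) _ _ (s≤s (s≤s _))
          (s≤s (s≤s i<i')) (s≤s (s≤s _)) (s≤s (s≤s j'<j)) _ T T' with <-cmp (i + j) (i' + j')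
... | tri< i+j<i'+j' _ _ =
  contradiction (minimal-markoff-product-unfolded T' (proj₁ T)) (<⇒≱ (F[2+i]*F[2+j]-gap i j i' j' 1≤i+j i+j<i'+j'))
  where
  1≤i+j : 1 ≤ i + j
  1≤i+j = ≤-trans (≤-trans (s≤s z≤n) j'<j) (m≤n+m j i)
... | tri> _ _ i'+j'<i+j =
  contradiction (minimal-markoff-product-unfolded T (proj₁ T')) (<⇒≱ (F[2+i]*F[2+j]-gap i' j' i j 1≤i'+j' i'+j'<i+j))
  where
  1≤i'+j' : 1 ≤ i' + j'
  1≤i'+j' = ≤-trans (≤-trans (s≤s z≤n) i<i') (m≤m+n i' j')
... | tri≈ _ i+j≡i'+j' _ = begin
    2 + i + (2 + j)    ≡⟨ solve (i ∷ j ∷ []) ⟩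
    4 + (i + j)        ≡⟨ cong (4 +_) i+j≡i'+j' ⟩
    4 + (i' + j')      ≡⟨ solve (i' ∷ j' ∷ []) ⟩
    2 + i' + (2 + j')  ∎
  where open ≡-Reasoning
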